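{- Let $n_1,\ldots,n_{d+1}$ be positive integers and let $B$ denote the $(d-1)$-dimensional partition with diagram $[n_2]\times\cdots\times[n_{d+1}]$ (all entries on $[n_2]\times\cdots\times[n_d]$ equal to $n_{d+1}$). Then $$g_{B}(1^{n_1 + 1}) = g_{B}(1^{n_1 + 1}; 1^{n_2}; \ldots; 1^{n_d}) = |\mathcal{P}(n_1,\ldots, n_{d+1})|,$$ where $1^k$ denotes $k$ variables all specialized to $1$.
   Context: A $k$-dimensional partition is an array $\pi=(\pi_{\mathbf{i}})_{\mathbf{i}\in\mathbb{Z}_+^k}$ of nonnegative integers with finitely many nonzero entries, weakly decreasing in each coordinate; $D(\pi)=\{(\mathbf{i},i)\in\mathbb{Z}_+^{k+1}:1\le i\le\pi_{\mathbf{i}}\}$. $\mathcal{P}(n_1,\ldots,n_{d+1})$ is the set of $d$-dimensional partitions with $D(\pi)\subseteq[n_1]\times\cdots\times[n_{d+1}]$. For a $d$-dimensional partition $\pi$: $\mathrm{Cor}(\pi)=\{\mathbf{i}\in D(\pi):\mathbf{i}+\mathbf{e}_\ell\notin D(\pi)\ \forall\ell\in[d]\}$, $\mathrm{sh}_1(\pi)=\{(i_2,\ldots,i_{d+1}):(i_1,\ldots,i_{d+1})\in D(\pi)\}$. For variables $\mathbf{x}^{(k)}=(x^{(k)}_1,\ldots,x^{(k)}_{m_k})$, $k\in[d]$, and a $(d-1)$-dimensional partition $\rho$ with $D(\rho)\subseteq[m_2]\times\cdots\times[m_d]\times\mathbb{Z}_+$, $g_\rho(\mathbf{x}^{(1)};\ldots;\mathbf{x}^{(d)})=\sum_{\pi}\prod_{(i_1,\ldots,i_{d+1})\in\mathrm{Cor}(\pi)}x^{(1)}_{i_1}\cdots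 x^{(d)}_{i_d}$, summed over $d$-dimensional partitions $\pi$ with $D(\pi)\subseteq[m_1]\times\cdots\times[m_d]\times\mathbb{Z}_+$ and $\mathrm{sh}_1(\pi)=D(\rho)$. The single-set version $g_\rho(\mathbf{x}^{(1)})$ is obtained by setting all $x^{(k)}_i=1$ for $k\ge 2$. -}

module Defs where

open import Level using (0ℓ)
open import Data.Nat using (ℕ; zero; suc; _≤_; _<_)
open import Data.Vec using (Vec; []; _∷_; _[_]%=_)
open import Data.Vec.Relation.Binary.Pointwise.Inductive using (Pointwise)
import Data.Vec.Relation.Binary.Pointwise.Inductive as PW
open import Data.Vec.Relation.Unary.All using (All)
open import Data.Fin using (Fin)
open import Data.Nat.Properties using (_<?_)
open import Data.Product using (Σ; ∃; _×_; proj₁)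
open import Function using (_⇔_)
open import Function.Bundles using (Inverse)
open import Relation.Binary.Bundles using (Setoid)
open import Relation.Binary.PropositionalEquality using (_≡_; refl; sym; trans)
open import Relation.Nullary.Decidable using (Dec; does)
open import Data.Bool using (if_then_else_)

-- A point of ℤ₊ (positive integers) is encoded by a natural
-- number c, representing the positive integer c + 1.  Hence the interval
-- [n] = {1,…,n} becomes {0,…,n-1}, i.e. the condition c < n.

Idx : ℕ → Set
Idx k = Vec ℕ k

Array : ℕ → Set
Array k = Idx k → ℕ

bump : ∀ {k} → Fin k → Idx k → Idx k
bump ℓ i = i [ ℓ ]%= suc

IsPartition : (k : ℕ) → Array k → Set
IsPartition k π =
  (∀ (i : Idx k) (ℓ : Fin k) → π (bump ℓ i) ≤ π i) ×
  ∃ λ (N : ℕ) → ∀ (i : Idx k) → 0 < π i → All (_< N) i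

Partition : ℕ → Set
Partition k = Σ (Array k) (IsPartition k)

-- Membership in the diagram D(π) ⊆ ℤ₊^(k+1): the point (i, c) lies in D(π)
-- iff 1 ≤ c+1 ≤ π_i, i.e. c < π_i.  (The last coordinate is kept separately.)
InD : ∀ {k} → Array k → Idx k → ℕ → Set
InD π i c = c < π i

InBox : ∀ {k} → Vec ℕ k → Idx k → Set
InBox bs i = Pointwise _<_ i bs

-- sh₁(π) = {(i₂,…,i_{k+1}) : (i₁,…,i_{k+1}) ∈ D(π)}, for π of dimension 1+k;
-- membership of (j, c) with j = (i₂,…,i_k), c = i_{k+1}.
InSh1 : ∀ {k} → Array (suc k) → Idx k → ℕ → Set
InSh1 π j c = ∃ λ (i₁ : ℕ) → InD π (i₁ ∷ j) c

Sh1Eq : ∀ {k} → Array (suc k) → Array k → Set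
Sh1Eq π ρ = ∀ (j : Idx _) (c : ℕ) → InSh1 π j c ⇔ InD ρ j c

boxArray : ∀ {k} → Vec ℕ k → ℕ → Array k
boxArray bs h i = if does (PW.decidable _<?_ i bs) then h else 0

SubPartitions : (k : ℕ) → (Partition k → Set) → Setoid 0ℓ 0ℓ
SubPartitions k Q = record
  { Carrier = Σ (Partition k) Q
  ; _≈_ = λ a b → ∀ (i : Idx k) → proj₁ (proj₁ a) i ≡ proj₁ (proj₁ b) i
  ; isEquivalence = record
    { refl = λ i → refl
    ; sym = λ p i → sym (p i)
    ; trans = λ p q i → trans (p i) (q i)
    }
  }

PSet : (k : ℕ) → Vec ℕ k → ℕ → Setoid 0ℓ 0ℓ
PSet k ns h = SubPartitions k
  (λ π → ∀ (i : Idx k) (c : ℕ) → InD (proj₁ π) i c → InBox ns i × c < h)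

-- Index set of the sum defining g_ρ(x⁽¹⁾;…;x⁽ᵈ⁾) with m = (m₁,…,m_d) variables:
-- d-dimensional π with D(π) ⊆ [m₁]×⋯×[m_d]×ℤ₊ and sh₁(π) = D(ρ).
-- With all variables specialised to 1 every monomial equals 1, so
-- g_ρ(1^{m₁};…;1^{m_d}) is the cardinality of this set.
GMultiSet : (e : ℕ) → Vec ℕ (suc e) → Array e → Setoid 0ℓ 0ℓ
GMultiSet e ms ρ = SubPartitions (suc e)
  (λ π → (∀ (i : Idx (suc e)) (c : ℕ) → InD (proj₁ π) i c → InBox ms i)
         × Sh1Eq (proj₁ π) ρ)

-- Index set of the sum defining the single-set version g_ρ(x⁽¹⁾) with m₁
-- variables (all x⁽ᵏ⁾ = 1 for k ≥ 2, no bound imposed on the coordinates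
-- i₂,…,i_d beyond sh₁(π) = D(ρ)): only the first coordinate is bounded by m₁.
-- g_ρ(1^{m₁}) is the cardinality of this set.
GSingleSet : (e : ℕ) → ℕ → Array e → Setoid 0ℓ 0ℓ
GSingleSet e m₁ ρ = SubPartitions (suc e)
  (λ π → (∀ (i₁ : ℕ) (j : Idx e) (c : ℕ) → InD (proj₁ π) (i₁ ∷ j) c → i₁ < m₁)
         × Sh1Eq (proj₁ π) ρ)

Equinumerous : Setoid 0ℓ 0ℓ → Setoid 0ℓ 0ℓ → Set
Equinumerous S T = Inverse S T

-- If sh₁(π) = D(ρ), every layer π(i₁, ·) lies inside D(ρ) and, π being
-- decreasing in i₁, the first layer π(1, ·) is all of D(ρ).  Deleting that
-- layer is therefore a bijection between the partitions counted by g_B(1^{n₁+1})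
-- and partitions whose remaining n₁ layers fit under B, i.e. 𝒫(n₁,…,n_{d+1}).
-- The extra bounds i_k ≤ n_k of the multi-set version hold automatically,
-- because they already hold on D(B).
module Submission where

open import Defs
open import Data.Nat using (ℕ; zero; suc; _<_; _≤_; _+_; z≤n; s≤s)
open import Data.Nat.Properties
  using ( _<?_; _≤?_; ≤-refl; ≤-trans; ≤-antisym; <-≤-trans; ≤-<-trans; <-irrefl; ≰⇒>
        ; n≤1+n; m≤m+n; m≤n+m)
open import Data.Vec using (Vec; []; _∷_)
open import Data.Vec.Relation.Unary.All using (All; []; _∷_)
import Data.Vec.Relation.Unary.All as All
open import Data.Vec.Relation.Binary.Pointwise.Inductive using (_∷_)
import Data.Vec.Relation.Binary.Pointwise.Inductive as PW
open import Data.Fin using (Fin; zero; suc)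
open import Data.Product using (_×_; _,_; proj₁)
open import Function.Bundles using (mk⇔; Equivalence)
open import Relation.Binary.Bundles using (Setoid)
open import Relation.Binary.PropositionalEquality using (_≡_; refl; sym)
open import Relation.Nullary using (yes; no)
open import Data.Empty using (⊥-elim)

Monotone : (k : ℕ) → Array k → Set
Monotone k π = ∀ (i : Idx k) (ℓ : Fin k) → π (bump ℓ i) ≤ π i

bump-InBox : ∀ {k} (ℓ : Fin k) (j : Idx k) (bs : Vec ℕ k) → InBox bs (bump ℓ j) → InBox bs j
bump-InBox zero    (x ∷ j) (b ∷ bs) (p ∷ ps) = ≤-trans (n≤1+n _) p ∷ ps
bump-InBox (suc ℓ) (x ∷ j) (b ∷ bs) (p ∷ ps) = p ∷ bump-InBox ℓ j bs ps

boxArray-≤ : ∀ {k} (bs : Vec ℕ k) (h : ℕ) (j : Idx k) → boxArray bs h j ≤ h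
boxArray-≤ bs h j with PW.decidable _<?_ j bs
... | yes _ = ≤-refl
... | no  _ = z≤n

boxArray-positive⇒InBox : ∀ {k} (bs : Vec ℕ k) (h : ℕ) (j : Idx k) →
                          0 < boxArray bs h j → InBox bs j
boxArray-positive⇒InBox bs h j p with PW.decidable _<?_ j bs
... | yes q = q
... | no  _ = ⊥-elim (<-irrefl refl p)

≤-boxArray : ∀ {k} (bs : Vec ℕ k) (h : ℕ) (j : Idx k) (x : ℕ) →
             (∀ c → c < x → InBox bs j × c < h) → x ≤ boxArray bs h j
≤-boxArray bs h j zero    _ = z≤n
≤-boxArray bs h j (suc x) below with below x ≤-refl
... | j∈bs , x<h with PW.decidable _<?_ j bs
...   | yes _    = x<h
...   | no  j∉bs = ⊥-elim (j∉bs j∈bs)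

boxArray-monotone : ∀ {k} (bs : Vec ℕ k) (h : ℕ) → Monotone k (boxArray bs h)
boxArray-monotone bs h j ℓ with PW.decidable _<?_ (bump ℓ j) bs | PW.decidable _<?_ j bs
... | yes _ | yes _    = ≤-refl
... | yes p | no  j∉bs = ⊥-elim (j∉bs (bump-InBox ℓ j bs p))
... | no  _ | _        = z≤n

sum : ∀ {k} → Vec ℕ k → ℕ
sum []       = 0
sum (b ∷ bs) = b + sum bs

InBox⇒All<sum : ∀ {k} (bs : Vec ℕ k) (i : Idx k) → InBox bs i → All (_< sum bs) i
InBox⇒All<sum []       []      PW.[]     = []
InBox⇒All<sum (b ∷ bs) (x ∷ i) (p ∷ ps) =
  ≤-trans p (m≤m+n b (sum bs)) ∷ All.map (λ q → ≤-trans q (m≤n+m (sum bs) b)) (InBox⇒All<sum bs i ps)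

boxArray-isPartition : ∀ {k} (bs : Vec ℕ k) (h : ℕ) → IsPartition k (boxArray bs h)
boxArray-isPartition bs h =
  boxArray-monotone bs h , sum bs , λ i p → InBox⇒All<sum bs i (boxArray-positive⇒InBox bs h i p)

peel : ∀ {k} → Array (suc k) → Array (suc k)
peel π (i₁ ∷ j) = π (suc i₁ ∷ j)

stack : ∀ {k} → Array k → Array (suc k) → Array (suc k)
stack ρ π (zero   ∷ j) = ρ j
stack ρ π (suc i₁ ∷ j) = π (i₁ ∷ j)

peel-isPartition : ∀ {k} (π : Array (suc k)) → IsPartition (suc k) π → IsPartition (suc k) (peel π)
peel-isPartition π (mono , N , fin) = mono′ , N , fin′
  where
  mono′ : Monotone _ (peel π)
  mono′ (i₁ ∷ j) zero    = mono (suc i₁ ∷ j) zero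
  mono′ (i₁ ∷ j) (suc ℓ) = mono (suc i₁ ∷ j) (suc ℓ)
  fin′ : ∀ i → 0 < peel π i → All (_< N) i
  fin′ (i₁ ∷ j) p with fin (suc i₁ ∷ j) p
  ... | q ∷ qs = ≤-trans (n≤1+n _) q ∷ qs

stack-isPartition : ∀ {k} (ρ : Array k) (π : Array (suc k)) →
                    IsPartition k ρ → IsPartition (suc k) π → (∀ j → π (0 ∷ j) ≤ ρ j) →
                    IsPartition (suc k) (stack ρ π)
stack-isPartition ρ π (monoρ , M , finρ) (monoπ , N , finπ) π≤ρ = mono , suc (M + N) , fin
  where
  mono : Monotone _ (stack ρ π)
  mono (zero   ∷ j) zero    = π≤ρ j
  mono (suc i₁ ∷ j) zero    = monoπ (i₁ ∷ j) zero
  mono (zero   ∷ j) (suc ℓ) = monoρ j ℓ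
  mono (suc i₁ ∷ j) (suc ℓ) = monoπ (i₁ ∷ j) (suc ℓ)
  <M⇒< : ∀ {x} → x < M → x < suc (M + N)
  <M⇒< x<M = ≤-trans x<M (≤-trans (m≤m+n M N) (n≤1+n _))
  <N⇒< : ∀ {x} → x < N → x < suc (M + N)
  <N⇒< x<N = ≤-trans x<N (≤-trans (m≤n+m N M) (n≤1+n _))
  fin : ∀ i → 0 < stack ρ π i → All (_< suc (M + N)) i
  fin (zero ∷ j) p = s≤s z≤n ∷ All.map <M⇒< (finρ j p)
  fin (suc i₁ ∷ j) p with finπ (i₁ ∷ j) p
  ... | q ∷ qs = s≤s (≤-trans q (m≤n+m N M)) ∷ All.map <N⇒< qs

head-≥ : ∀ {k} (π : Array (suc k)) → Monotone (suc k) π → ∀ i₁ j → π (i₁ ∷ j) ≤ π (0 ∷ j)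
head-≥ π mono zero     j = ≤-refl
head-≥ π mono (suc i₁) j = ≤-trans (mono (i₁ ∷ j) zero) (head-≥ π mono i₁ j)

Sh1Eq⇒≤ : ∀ {k} (π : Array (suc k)) (ρ : Array k) → Sh1Eq π ρ → ∀ i₁ j → π (i₁ ∷ j) ≤ ρ j
Sh1Eq⇒≤ π ρ sh i₁ j with π (i₁ ∷ j) ≤? ρ j
... | yes p  = p
... | no  ¬p = ⊥-elim (<-irrefl refl (Equivalence.to (sh j (ρ j)) (i₁ , ≰⇒> ¬p)))

Sh1Eq⇒head≡ : ∀ {k} (π : Array (suc k)) (ρ : Array k) → Monotone (suc k) π → Sh1Eq π ρ →
              ∀ j → π (0 ∷ j) ≡ ρ j
Sh1Eq⇒head≡ π ρ mono sh j with ρ j ≤? π (0 ∷ j)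
... | yes p  = ≤-antisym (Sh1Eq⇒≤ π ρ sh 0 j) p
... | no  ¬p with Equivalence.from (sh j (π (0 ∷ j))) (≰⇒> ¬p)
...   | i₁ , q = ⊥-elim (<-irrefl refl (<-≤-trans q (head-≥ π mono i₁ j)))

stack-Sh1Eq : ∀ {k} (ρ : Array k) (π : Array (suc k)) → (∀ i₁ j → π (i₁ ∷ j) ≤ ρ j) →
              Sh1Eq (stack ρ π) ρ
stack-Sh1Eq ρ π π≤ρ j c = mk⇔ stacked⇒ρ (λ c<ρ → 0 , c<ρ)
  where
  stacked⇒ρ : InSh1 (stack ρ π) j c → InD ρ j c
  stacked⇒ρ (zero   , c<ρ) = c<ρ
  stacked⇒ρ (suc i₁ , c<π) = <-≤-trans c<π (π≤ρ i₁ j)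

GSingleSet↔GMultiSet : ∀ {e} (m : ℕ) (ms : Vec ℕ e) (ρ : Array e) →
                       (∀ j → 0 < ρ j → InBox ms j) →
                       Equinumerous (GSingleSet e m ρ) (GMultiSet e (m ∷ ms) ρ)
GSingleSet↔GMultiSet m ms ρ supp = record
  { to        = λ { (π , i₁<m , sh) → π , inBox i₁<m sh , sh }
  ; from      = λ { (π , inB , sh) → π , (λ i₁ j c d → PW.head (inB (i₁ ∷ j) c d)) , sh }
  ; to-cong   = λ p → p
  ; from-cong = λ p → p
  ; inverse   = (λ p → p) , (λ p → p)
  }
  where
  inBox : ∀ {π : Array _} → (∀ i₁ j c → InD π (i₁ ∷ j) c → i₁ < m) → Sh1Eq π ρ →
          ∀ i c → InD π i c → InBox (m ∷ ms) i
  inBox i₁<m sh (i₁ ∷ j) c d =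
    i₁<m i₁ j c d ∷ supp j (≤-<-trans z≤n (Equivalence.to (sh j c) (i₁ , d)))

GMultiSet↔PSet : ∀ {e} (n₁ : ℕ) (mids : Vec ℕ e) (top : ℕ) →
                 Equinumerous (GMultiSet e (suc n₁ ∷ mids) (boxArray mids top))
                              (PSet (suc e) (n₁ ∷ mids) top)
GMultiSet↔PSet {e} n₁ mids top = record
  { to        = to
  ; from      = from
  ; to-cong   = λ { p (i₁ ∷ j) → p (suc i₁ ∷ j) }
  ; from-cong = λ { p (zero ∷ j) → refl ; p (suc i₁ ∷ j) → p (i₁ ∷ j) }
  ; inverse   = (λ { p (i₁ ∷ j) → p (suc i₁ ∷ j) })
              , (λ { {((π , mono , _) , _ , sh)} p (zero ∷ j) → sym (Sh1Eq⇒head≡ π B mono sh j)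
                   ; p (suc i₁ ∷ j) → p (i₁ ∷ j) })
  }
  where
  B : Array e
  B = boxArray mids top

  G P : Set
  G = Setoid.Carrier (GMultiSet e (suc n₁ ∷ mids) B)
  P = Setoid.Carrier (PSet (suc e) (n₁ ∷ mids) top)

  to : G → P
  to ((π , isP) , inB , sh) = (peel π , peel-isPartition π isP) , inBox
    where
    inBox : ∀ i c → InD (peel π) i c → InBox (n₁ ∷ mids) i × c < top
    inBox (i₁ ∷ j) c d with inB (suc i₁ ∷ j) c d
    ... | s≤s q ∷ qs =
      (q ∷ qs) , <-≤-trans d (≤-trans (Sh1Eq⇒≤ π B sh (suc i₁) j) (boxArray-≤ mids top j))

  from : P → G
  from ((π , isP) , inBoxπ) =
    (stack B π , stack-isPartition B π (boxArray-isPartition mids top) isP (λ j → π≤B 0 j)) ,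
    inBox , stack-Sh1Eq B π π≤B
    where
    π≤B : ∀ i₁ j → π (i₁ ∷ j) ≤ B j
    π≤B i₁ j = ≤-boxArray mids top j (π (i₁ ∷ j)) λ c d →
      let j∈mids , c<top = inBoxπ (i₁ ∷ j) c d in PW.tail j∈mids , c<top
    inBox : ∀ i c → InD (stack B π) i c → InBox (suc n₁ ∷ mids) i
    inBox (zero ∷ j)   c d = s≤s z≤n ∷ boxArray-positive⇒InBox mids top j (≤-<-trans z≤n d)
    inBox (suc i₁ ∷ j) c d with proj₁ (inBoxπ (i₁ ∷ j) c d)
    ... | q ∷ qs = s≤s q ∷ qs

proposition6p7 : (e : ℕ) (n₁ : ℕ) (mids : Vec ℕ e) (top : ℕ)
    → 0 < n₁ → All (0 <_) mids → 0 < top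
    → Equinumerous (GSingleSet e (suc n₁) (boxArray mids top))
                   (GMultiSet e (suc n₁ ∷ mids) (boxArray mids top))
      × Equinumerous (GMultiSet e (suc n₁ ∷ mids) (boxArray mids top))
                     (PSet (suc e) (n₁ ∷ mids) top)
proposition6p7 e n₁ mids top _ _ _ =
  GSingleSet↔GMultiSet (suc n₁) mids (boxArray mids top) (boxArray-positive⇒InBox mids top) ,
  GMultiSet↔PSet n₁ mids top
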